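{- Let $G$ be a graph of order $n$ and size $m$ with no isolated vertices, and let $e$ and $p$ be the numbers of end-vertices and penultimate vertices of $G$, respectively. Then $$\gamma_{\times2}(G)\geq\frac{4n-2m+e-p}{3}.$$ Furthermore, equality holds if and only if $G\in\Omega$.
   Context: An end-vertex is a vertex of degree one; a penultimate vertex is a vertex adjacent to an end-vertex. A set $S\subseteq V(G)$ is a double dominating set if $|N[v]\cap S|\geq2$ for every vertex $v$ (with $N[v]$ the closed neighborhood); $\gamma_{\times2}(G)$ is the minimum size of such a set. The family $\Omega$ is defined as follows: take a bipartite graph $H$ with partite sets $X$ and $Y$ such that every vertex of $X$ has degree two; add a set $M$ of new edges forming a matching whose edges join some vertices of $Y$ that have neighbors in $X$; then to each vertex of $Y$ not saturated by $M$ attach at least one new end-vertex (pendant vertex). $\Omega$ is the family of all graphs $G$ obtained in this way. -}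

module Defs where

open import Data.Bool using (Bool; true; false; _∧_; _∨_; not)
open import Data.Nat using (ℕ; _<ᵇ_; _≡ᵇ_)
open import Data.Fin using (Fin; toℕ; _≟_)
open import Data.List using (List; length; filterᵇ; map)
open import Data.Nat.ListAction using (sum)
open import Data.Bool.ListAction using (any)
open import Data.List using () renaming (allFin to allFinL)
open import Data.Product using (Σ; ∃; _×_)
open import Data.Sum using (_⊎_)
open import Data.Nat using (_≤_)
open import Relation.Nullary using (¬_)
open import Relation.Nullary.Decidable using (⌊_⌋)
open import Relation.Binary.PropositionalEquality using (_≡_)

record Graph (n : ℕ) : Set where
  field
    adj    : Fin n → Fin n → Bool
    sym    : ∀ u v → adj u v ≡ adj v u
    irrefl : ∀ u → adj u u ≡ false
open Graph public

count : {n : ℕ} → (Fin n → Bool) → ℕ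
count {n} f = length (filterᵇ f (allFinL n))

Adj : {n : ℕ} → Graph n → Fin n → Fin n → Set
Adj G u v = adj G u v ≡ true

deg : {n : ℕ} → Graph n → Fin n → ℕ
deg G v = count (adj G v)

sumFin : {n : ℕ} → (Fin n → ℕ) → ℕ
sumFin {n} f = sum (map f (allFinL n))

size : {n : ℕ} → Graph n → ℕ
size G = sumFin (λ u → count (λ v → (toℕ u <ᵇ toℕ v) ∧ adj G u v))

NoIsolated : {n : ℕ} → Graph n → Set
NoIsolated {n} G = ∀ (v : Fin n) → ∃ λ u → Adj G v u

isEnd : {n : ℕ} → Graph n → Fin n → Bool
isEnd G v = deg G v ≡ᵇ 1

isPenult : {n : ℕ} → Graph n → Fin n → Bool
isPenult {n} G v = any (λ u → adj G v u ∧ isEnd G u) (allFinL n)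

numEnd : {n : ℕ} → Graph n → ℕ
numEnd G = count (isEnd G)

numPenult : {n : ℕ} → Graph n → ℕ
numPenult G = count (isPenult G)

closedNbhdMeet : {n : ℕ} → Graph n → (Fin n → Bool) → Fin n → ℕ
closedNbhdMeet G S v = count (λ u → (⌊ u ≟ v ⌋ ∨ adj G v u) ∧ S u)

IsDoubleDominating : {n : ℕ} → Graph n → (Fin n → Bool) → Set
IsDoubleDominating {n} G S = ∀ (v : Fin n) → 2 ≤ closedNbhdMeet G S v

-- S is a minimum double dominating set, i.e. count S = γ×2(G)
IsMinDoubleDominating : {n : ℕ} → Graph n → (Fin n → Bool) → Set
IsMinDoubleDominating {n} G S =
  IsDoubleDominating G S ×
  (∀ (T : Fin n → Bool) → IsDoubleDominating G T → count S ≤ count T)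

-- Roles of vertices in the construction of Ω:
-- X, Y = partite sets of H; L = attached pendant vertices.
data Role : Set where
  rX rY rL : Role

-- G ∈ Ω (up to isomorphism): the vertices of G can be labelled X/Y/L
-- so that G arises from the construction.
record IsOmegaLabelling {n : ℕ} (G : Graph n) (r : Fin n → Role) : Set where
  field
    X-nbrs-Y   : ∀ u v → r u ≡ rX → Adj G u v → r v ≡ rY
    X-deg2     : ∀ u → r u ≡ rX → deg G u ≡ 2
    -- edges inside Y (the set M) form a matching
    M-matching : ∀ u v w → r u ≡ rY → r v ≡ rY → r w ≡ rY →
                 Adj G u v → Adj G u w → v ≡ w
    M-ends-X   : ∀ u v → r u ≡ rY → r v ≡ rY → Adj G u v →
                 ∃ λ x → r x ≡ rX × Adj G u x
    L-deg1     : ∀ u → r u ≡ rL → deg G u ≡ 1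
    L-attach   : ∀ u v → r u ≡ rL → Adj G u v →
                 r v ≡ rY × (∀ w → r w ≡ rY → ¬ Adj G v w)
    -- every Y vertex not saturated by M has at least one attached end-vertex
    Y-unsat-L  : ∀ u → r u ≡ rY →
                 (∃ λ w → r w ≡ rY × Adj G u w) ⊎ (∃ λ l → r l ≡ rL × Adj G u l)

InOmega : {n : ℕ} → Graph n → Set
InOmega {n} G = ∃ λ (r : Fin n → Role) → IsOmegaLabelling G r

-- Give every vertex v the demand 4 + k(v), where k(v) is the number of end-vertices adjacent
-- to v, and, relative to a vertex set S, the charge
--   (3 if v ∈ S, deg v otherwise) + |N(v) ∩ S| + [v is penultimate].
-- The demands add up to 4n + e, each end-vertex being counted once, by its neighbour; the charges
-- add up to 3|S| + 2m + p, because Σ_v |N(v) ∩ S| = Σ_{u ∈ S} deg u. If S is double dominating,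
-- then every end-vertex and every neighbour of an end-vertex lies in S, and the charge of each
-- vertex covers its demand. Equality forces every vertex to be tight: a vertex outside S has
-- degree 2 and both neighbours in S, a non-penultimate vertex of S has exactly one neighbour in S,
-- and the neighbours in S of a penultimate vertex of S are end-vertices. Labelling V ∖ S as X,
-- the end-vertices as L (except for one vertex of each K₂ component) and the rest of S as Y
-- exhibits G ∈ Ω. Conversely, for G ∈ Ω the set Y ∪ L is double dominating and its charges are at
-- most the demands, so a minimum double dominating set attains the bound.

module Submission where

open import Defs
open import Data.Nat using (ℕ; _+_; _*_; _≤_)
open import Data.Fin using (Fin)
open import Data.Bool using (Bool)
open import Data.Product using (_×_)
open import Function.Bundles using (_⇔_)
open import Relation.Binary.PropositionalEquality using (_≡_)

open import Data.Bool using (true; false; _∧_; _∨_; not; if_then_else_)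
open import Data.Bool.ListAction using (any)
open import Data.Bool.Properties using (T-≡; ∧-identityʳ; ¬-not)
open import Data.Empty using (⊥; ⊥-elim)
open import Data.Fin using (zero; suc; toℕ; _≟_)
open import Data.Fin.Properties using (toℕ-injective) renaming (suc-injective to Fin-suc-injective)
open import Data.List using (length; filterᵇ; map; tabulate; allFin)
open import Data.List.Membership.Propositional using (lose)
open import Data.List.Membership.Propositional.Properties using (∈-allFin)
open import Data.List.Relation.Unary.Any using (satisfied)
open import Data.List.Relation.Unary.Any.Properties using (any⁺; any⁻)
import Data.Nat.ListAction as List
open import Data.Nat using (zero; suc; _<_; z≤n; s≤s; s≤s⁻¹; _<ᵇ_)
open import Data.Nat.Properties
  using ( ≤-refl; ≤-reflexive; ≤-trans; ≤-antisym; <-asym; <-cmp; ≮⇒≥; ≤∧≢⇒<; suc-injective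
        ; +-comm; +-identityʳ; *-comm; +-mono-≤; +-monoˡ-≤; +-monoʳ-≤; *-monoʳ-≤; m≤m+n; m≤n+m
        ; +-cancelˡ-≤; +-cancelʳ-≤; +-cancelˡ-≡; <ᵇ⇒<; <⇒<ᵇ; <ᵇ-reflects-<; ≡ᵇ⇒≡; ≡⇒≡ᵇ
        ; +-*-semiring; module ≤-Reasoning )
open import Algebra.Properties.Semiring.Sum +-*-semiring
  using (sum; sum-syntax; sum-cong-≗; ∑-distrib-+; ∑-comm; *-distribˡ-sum)
open import Data.Product using (∃; _,_; proj₁; proj₂; uncurry)
open import Data.Sum using (_⊎_; inj₁; inj₂; [_,_]′)
open import Function using (_∘_; Equivalence; mk⇔)
open import Relation.Binary.Definitions using (tri<; tri≈; tri>)
open import Relation.Nullary using (¬_; yes; no)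
open import Relation.Nullary.Decidable using (⌊_⌋; isYes≗does; dec-true; dec-false)
open import Relation.Nullary.Reflects using (ofʸ; ofⁿ)
import Relation.Binary.PropositionalEquality as ≡
open ≡ using (refl; trans; cong; cong₂; subst; subst₂; _≢_; module ≡-Reasoning)

𝕀 : Bool → ℕ
𝕀 true  = 1
𝕀 false = 0

𝕀≤1 : ∀ b → 𝕀 b ≤ 1
𝕀≤1 true  = ≤-refl
𝕀≤1 false = z≤n

𝕀-∧ : ∀ a b → 𝕀 (a ∧ b) ≡ 𝕀 a * 𝕀 b
𝕀-∧ true  b = ≡.sym (+-identityʳ (𝕀 b))
𝕀-∧ false b = refl

1≤𝕀⇒≡true : ∀ {b} → 1 ≤ 𝕀 b → b ≡ true
1≤𝕀⇒≡true {true} _ = refl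

𝕀-injective : ∀ {a b} → 𝕀 a ≡ 𝕀 b → a ≡ b
𝕀-injective {true}  {true}  _ = refl
𝕀-injective {false} {false} _ = refl

∧-≡true⁻ : ∀ {a b} → a ∧ b ≡ true → a ≡ true × b ≡ true
∧-≡true⁻ {true} {true} _ = refl , refl

1≤𝕀 : ∀ {b} → b ≡ true → 1 ≤ 𝕀 b
1≤𝕀 refl = ≤-refl

false≢true : false ≢ true
false≢true ()

not≡true⇒ : ∀ {b} → not b ≡ true → b ≡ false
not≡true⇒ {false} _ = refl

∧-not≡false⇒ : ∀ {a b} → a ≡ true → a ∧ not b ≡ false → b ≡ true
∧-not≡false⇒ {true} {true}  _ _  = refl
∧-not≡false⇒ {true} {false} _ ()

sum-zero : ∀ {n} {f : Fin n → ℕ} → (∀ i → f i ≡ 0) → sum f ≡ 0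
sum-zero {zero}  _ = refl
sum-zero {suc n} f≡0 rewrite f≡0 zero = sum-zero (f≡0 ∘ suc)

sum-supported : ∀ {n} (f : Fin n → ℕ) j → (∀ i → i ≢ j → f i ≡ 0) → sum f ≡ f j
sum-supported f zero    f≡0 =
  trans (cong (f zero +_) (sum-zero (λ i → f≡0 (suc i) λ ()))) (+-identityʳ (f zero))
sum-supported f (suc j) f≡0 rewrite f≡0 zero (λ ()) =
  sum-supported (f ∘ suc) j (λ i i≢j → f≡0 (suc i) (i≢j ∘ Fin-suc-injective))

sum-const : ∀ m c → ∑[ i < m ] c ≡ m * c
sum-const zero    c = refl
sum-const (suc m) c = cong (c +_) (sum-const m c)

≤-sum : ∀ {n} (f : Fin n → ℕ) i → f i ≤ sum f
≤-sum f zero    = m≤m+n (f zero) _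
≤-sum f (suc i) = ≤-trans (≤-sum (f ∘ suc) i) (m≤n+m _ (f zero))

sum-mono-≤ : ∀ {n} {f g : Fin n → ℕ} → (∀ i → f i ≤ g i) → sum f ≤ sum g
sum-mono-≤ {zero}  _   = z≤n
sum-mono-≤ {suc n} f≤g = +-mono-≤ (f≤g zero) (sum-mono-≤ (f≤g ∘ suc))

sum-mono-≤-equality : ∀ {n} {f g : Fin n → ℕ} → (∀ i → f i ≤ g i) → sum g ≤ sum f → ∀ i → f i ≡ g i
sum-mono-≤-equality {suc n} {f} {g} f≤g Σg≤Σf zero = ≤-antisym (f≤g zero)
  (+-cancelʳ-≤ (sum (g ∘ suc)) (g zero) (f zero)
    (≤-trans Σg≤Σf (+-monoʳ-≤ (f zero) (sum-mono-≤ (f≤g ∘ suc)))))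
sum-mono-≤-equality {suc n} {f} {g} f≤g Σg≤Σf (suc i) = sum-mono-≤-equality (f≤g ∘ suc)
  (+-cancelˡ-≤ (g zero) _ _ (≤-trans Σg≤Σf (+-monoˡ-≤ (sum (f ∘ suc)) (f≤g zero)))) i

1≤sum⇒∃ : ∀ {n} (f : Fin n → ℕ) → 1 ≤ sum f → ∃ λ i → 1 ≤ f i
1≤sum⇒∃ {suc n} f 1≤Σf with f zero in f₀
... | suc _ = zero , subst (1 ≤_) (≡.sym f₀) (s≤s z≤n)
... | zero  with 1≤sum⇒∃ (f ∘ suc) 1≤Σf
...   | i , 1≤fi = suc i , 1≤fi

sum≤1⇒unique : ∀ {n} (f : Fin n → ℕ) {i j} → sum f ≤ 1 → 1 ≤ f i → 1 ≤ f j → i ≡ j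
sum≤1⇒unique f {zero}  {zero}  _ _ _ = refl
sum≤1⇒unique f {zero}  {suc j} Σf≤1 1≤fi 1≤fj
  with s≤s () ← ≤-trans (+-mono-≤ 1≤fi (≤-trans 1≤fj (≤-sum (f ∘ suc) j))) Σf≤1
sum≤1⇒unique f {suc i} {zero}  Σf≤1 1≤fi 1≤fj
  with s≤s () ← ≤-trans (+-mono-≤ 1≤fj (≤-trans 1≤fi (≤-sum (f ∘ suc) i))) Σf≤1
sum≤1⇒unique f {suc i} {suc j} Σf≤1 1≤fi 1≤fj =
  cong suc (sum≤1⇒unique (f ∘ suc) (≤-trans (m≤n+m _ (f zero)) Σf≤1) 1≤fi 1≤fj)

length-filterᵇ-tabulate : ∀ {n} {A : Set} (p : A → Bool) (f : Fin n → A) →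
  length (filterᵇ p (tabulate f)) ≡ ∑[ i < n ] 𝕀 (p (f i))
length-filterᵇ-tabulate {zero}  p f = refl
length-filterᵇ-tabulate {suc n} p f with p (f zero)
... | true  = cong suc (length-filterᵇ-tabulate p (f ∘ suc))
... | false = length-filterᵇ-tabulate p (f ∘ suc)

count≡sum : ∀ {n} (p : Fin n → Bool) → count p ≡ ∑[ i < n ] 𝕀 (p i)
count≡sum p = length-filterᵇ-tabulate p (λ i → i)

sum-map-tabulate : ∀ {n} {A : Set} (g : A → ℕ) (f : Fin n → A) → List.sum (map g (tabulate f)) ≡ sum (g ∘ f)
sum-map-tabulate {zero}  g f = refl
sum-map-tabulate {suc n} g f = cong (g (f zero) +_) (sum-map-tabulate g (f ∘ suc))

any-allFin⁻ : ∀ {n} (p : Fin n → Bool) → any p (allFin n) ≡ true → ∃ λ i → p i ≡ true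
any-allFin⁻ {n} p any≡true with i , pi ← satisfied (any⁻ p (allFin n) (Equivalence.from T-≡ any≡true)) =
  i , Equivalence.to T-≡ pi

any-allFin⁺ : ∀ {n} (p : Fin n → Bool) i → p i ≡ true → any p (allFin n) ≡ true
any-allFin⁺ p i pi = Equivalence.to T-≡ (any⁺ p (lose (∈-allFin i) (Equivalence.from T-≡ pi)))

module _ {n : ℕ} (G : Graph n) where

  Adj-sym : ∀ {u v} → Adj G u v → Adj G v u
  Adj-sym {u} {v} uv = trans (Graph.sym G v u) uv

  Adj-irrefl : ∀ {v} → ¬ Adj G v v
  Adj-irrefl {v} vv = false≢true (trans (≡.sym (irrefl G v)) vv)

  degIn : (Fin n → Bool) → Fin n → ℕ
  degIn W v = ∑[ u < n ] 𝕀 (adj G v u ∧ W u)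

  endDeg : Fin n → ℕ
  endDeg = degIn (isEnd G)

  deg≡sum : ∀ v → deg G v ≡ ∑[ u < n ] 𝕀 (adj G v u)
  deg≡sum v = count≡sum (adj G v)

  deg≡degIn-all : ∀ v → deg G v ≡ degIn (λ _ → true) v
  deg≡degIn-all v = trans (deg≡sum v) (sum-cong-≗ λ u → cong 𝕀 (≡.sym (∧-identityʳ (adj G v u))))

  𝕀-nbr-mono : ∀ {W W′ : Fin n → Bool} {v} → (∀ u → Adj G v u → W u ≡ true → W′ u ≡ true) →
    ∀ u → 𝕀 (adj G v u ∧ W u) ≤ 𝕀 (adj G v u ∧ W′ u)
  𝕀-nbr-mono {W} {W′} {v} W⊆W′ u with adj G v u in vu | W u in Wu
  ... | true  | true  rewrite W⊆W′ u vu Wu = ≤-refl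
  ... | true  | false = z≤n
  ... | false | _     = z≤n

  degIn-mono : ∀ {W W′ : Fin n → Bool} {v} → (∀ u → Adj G v u → W u ≡ true → W′ u ≡ true) →
    degIn W v ≤ degIn W′ v
  degIn-mono W⊆W′ = sum-mono-≤ (𝕀-nbr-mono W⊆W′)

  degIn-mono-equality : ∀ {W W′ : Fin n → Bool} {v} → (∀ u → Adj G v u → W u ≡ true → W′ u ≡ true) →
    degIn W′ v ≤ degIn W v → ∀ u → Adj G v u → W′ u ≡ true → W u ≡ true
  degIn-mono-equality W⊆W′ W′≤W u vu W′u =
    proj₂ (∧-≡true⁻ (𝕀-injective
      (trans (sum-mono-≤-equality (𝕀-nbr-mono W⊆W′) W′≤W u) (cong 𝕀 (cong₂ _∧_ vu W′u)))))

  degIn≤deg : ∀ W v → degIn W v ≤ deg G v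
  degIn≤deg W v = ≤-trans (degIn-mono (λ _ _ _ → refl)) (≤-reflexive (≡.sym (deg≡degIn-all v)))

  1≤degIn : ∀ {W : Fin n → Bool} {v u} → Adj G v u → W u ≡ true → 1 ≤ degIn W v
  1≤degIn {u = u} vu Wu = ≤-trans (1≤𝕀 (cong₂ _∧_ vu Wu)) (≤-sum _ u)

  degIn-witness : ∀ {W : Fin n → Bool} {v} → 1 ≤ degIn W v → ∃ λ u → Adj G v u × W u ≡ true
  degIn-witness 1≤d with u , 1≤du ← 1≤sum⇒∃ _ 1≤d = u , ∧-≡true⁻ (1≤𝕀⇒≡true 1≤du)

  degIn≡0 : ∀ {W : Fin n → Bool} {v} → (∀ u → Adj G v u → W u ≡ true → ⊥) → degIn W v ≡ 0
  degIn≡0 {W} {v} none = sum-zero nbr∉W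
    where
      nbr∉W : ∀ u → 𝕀 (adj G v u ∧ W u) ≡ 0
      nbr∉W u with adj G v u ∧ W u in e
      ... | true  = ⊥-elim (uncurry (none u) (∧-≡true⁻ e))
      ... | false = refl

  degIn≤1 : ∀ {W : Fin n → Bool} {v} w → (∀ u → Adj G v u → W u ≡ true → u ≡ w) → degIn W v ≤ 1
  degIn≤1 {W} {v} w only-w = subst (_≤ 1) (≡.sym (sum-supported _ w off-w)) (𝕀≤1 _)
    where
      off-w : ∀ u → u ≢ w → 𝕀 (adj G v u ∧ W u) ≡ 0
      off-w u u≢w with adj G v u ∧ W u in e
      ... | true  = ⊥-elim (u≢w (uncurry (only-w u) (∧-≡true⁻ e)))
      ... | false = refl

  degIn≤1-unique : ∀ {W : Fin n → Bool} {v a b} → degIn W v ≤ 1 →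
    Adj G v a → W a ≡ true → Adj G v b → W b ≡ true → a ≡ b
  degIn≤1-unique d≤1 va Wa vb Wb = sum≤1⇒unique _ d≤1 (1≤𝕀 (cong₂ _∧_ va Wa)) (1≤𝕀 (cong₂ _∧_ vb Wb))

  isEnd⇒deg≡1 : ∀ {u} → isEnd G u ≡ true → deg G u ≡ 1
  isEnd⇒deg≡1 {u} e = ≡ᵇ⇒≡ (deg G u) 1 (Equivalence.from T-≡ e)

  deg≡1⇒isEnd : ∀ {u} → deg G u ≡ 1 → isEnd G u ≡ true
  deg≡1⇒isEnd {u} d = Equivalence.to T-≡ (≡⇒≡ᵇ (deg G u) 1 d)

  end-nbr-unique : ∀ {u a b} → isEnd G u ≡ true → Adj G u a → Adj G u b → a ≡ b
  end-nbr-unique {u} e ua ub =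
    degIn≤1-unique (≤-reflexive (trans (≡.sym (deg≡degIn-all u)) (isEnd⇒deg≡1 e))) ua refl ub refl

  isPenult⇒ : ∀ {v} → isPenult G v ≡ true → ∃ λ u → Adj G v u × isEnd G u ≡ true
  isPenult⇒ p with u , e ← any-allFin⁻ _ p = u , ∧-≡true⁻ e

  ⇒isPenult : ∀ {v u} → Adj G v u → isEnd G u ≡ true → isPenult G v ≡ true
  ⇒isPenult {v} {u} vu eu = any-allFin⁺ (λ u → adj G v u ∧ isEnd G u) u (cong₂ _∧_ vu eu)

  𝕀-isPenult≤endDeg : ∀ v → 𝕀 (isPenult G v) ≤ endDeg v
  𝕀-isPenult≤endDeg v with isPenult G v in p
  ... | false = z≤n
  ... | true with _ , vu , eu ← isPenult⇒ p = 1≤degIn vu eu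

  ¬isPenult⇒endDeg≡0 : ∀ {v} → isPenult G v ≡ false → endDeg v ≡ 0
  ¬isPenult⇒endDeg≡0 p = degIn≡0 λ u vu eu → false≢true (trans (≡.sym p) (⇒isPenult vu eu))

  closedNbhdMeet≡ : ∀ S v → closedNbhdMeet G S v ≡ 𝕀 (S v) + degIn S v
  closedNbhdMeet≡ S v = begin
    closedNbhdMeet G S v
      ≡⟨ count≡sum (λ u → (⌊ u ≟ v ⌋ ∨ adj G v u) ∧ S u) ⟩
    ∑[ u < n ] 𝕀 ((⌊ u ≟ v ⌋ ∨ adj G v u) ∧ S u)
      ≡⟨ sum-cong-≗ split ⟩
    ∑[ u < n ] (𝕀 (⌊ u ≟ v ⌋ ∧ S u) + 𝕀 (adj G v u ∧ S u))
      ≡⟨ ∑-distrib-+ (λ u → 𝕀 (⌊ u ≟ v ⌋ ∧ S u)) (λ u → 𝕀 (adj G v u ∧ S u)) ⟩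
    ∑[ u < n ] 𝕀 (⌊ u ≟ v ⌋ ∧ S u) + degIn S v
      ≡⟨ cong (_+ degIn S v) (sum-supported _ v off-v) ⟩
    𝕀 (⌊ v ≟ v ⌋ ∧ S v) + degIn S v
      ≡⟨ cong (λ b → 𝕀 (b ∧ S v) + degIn S v) (trans (isYes≗does (v ≟ v)) (dec-true (v ≟ v) refl)) ⟩
    𝕀 (S v) + degIn S v
      ∎
    where
      open ≡-Reasoning
      split : ∀ u → 𝕀 ((⌊ u ≟ v ⌋ ∨ adj G v u) ∧ S u) ≡ 𝕀 (⌊ u ≟ v ⌋ ∧ S u) + 𝕀 (adj G v u ∧ S u)
      split u with u ≟ v
      ... | yes refl rewrite irrefl G u = ≡.sym (+-identityʳ _)
      ... | no _     = refl
      off-v : ∀ u → u ≢ v → 𝕀 (⌊ u ≟ v ⌋ ∧ S u) ≡ 0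
      off-v u u≢v = cong (λ b → 𝕀 (b ∧ S u)) (trans (isYes≗does (u ≟ v)) (dec-false (u ≟ v) u≢v))

  ∑-degIn : ∀ W → ∑[ v < n ] degIn W v ≡ ∑[ u < n ] (𝕀 (W u) * deg G u)
  ∑-degIn W = begin
    ∑[ v < n ] ∑[ u < n ] 𝕀 (adj G v u ∧ W u)
      ≡⟨ ∑-comm (λ v u → 𝕀 (adj G v u ∧ W u)) ⟩
    ∑[ u < n ] ∑[ v < n ] 𝕀 (adj G v u ∧ W u)
      ≡⟨ sum-cong-≗ (λ u → sum-cong-≗ (reorient u)) ⟩
    ∑[ u < n ] ∑[ v < n ] (𝕀 (W u) * 𝕀 (adj G u v))
      ≡⟨ sum-cong-≗ (λ u → *-distribˡ-sum (𝕀 (W u)) (λ v → 𝕀 (adj G u v))) ⟨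
    ∑[ u < n ] (𝕀 (W u) * ∑[ v < n ] 𝕀 (adj G u v))
      ≡⟨ sum-cong-≗ (λ u → cong (𝕀 (W u) *_) (deg≡sum u)) ⟨
    ∑[ u < n ] (𝕀 (W u) * deg G u)
      ∎
    where
      open ≡-Reasoning
      reorient : ∀ u v → 𝕀 (adj G v u ∧ W u) ≡ 𝕀 (W u) * 𝕀 (adj G u v)
      reorient u v rewrite Graph.sym G v u = trans (𝕀-∧ (adj G u v) (W u)) (*-comm (𝕀 (adj G u v)) (𝕀 (W u)))

  handshake : ∑[ u < n ] deg G u ≡ 2 * size G
  handshake = begin
    ∑[ u < n ] deg G u
      ≡⟨ sum-cong-≗ deg≡sum ⟩
    ∑[ u < n ] ∑[ v < n ] 𝕀 (adj G u v)
      ≡⟨ sum-cong-≗ (λ u → sum-cong-≗ (split-by-order u)) ⟩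
    ∑[ u < n ] ∑[ v < n ] (up u v + up v u)
      ≡⟨ sum-cong-≗ (λ u → ∑-distrib-+ (up u) (λ v → up v u)) ⟩
    ∑[ u < n ] (∑[ v < n ] up u v + ∑[ v < n ] up v u)
      ≡⟨ ∑-distrib-+ (λ u → ∑[ v < n ] up u v) (λ u → ∑[ v < n ] up v u) ⟩
    s + ∑[ u < n ] ∑[ v < n ] up v u
      ≡⟨ cong (s +_) (∑-comm up) ⟨
    s + s
      ≡⟨ cong (s +_) (+-identityʳ s) ⟨
    2 * s
      ≡⟨ cong (2 *_) size≡s ⟨
    2 * size G
      ∎
    where
      open ≡-Reasoning
      up : Fin n → Fin n → ℕ
      up u v = 𝕀 ((toℕ u <ᵇ toℕ v) ∧ adj G u v)
      s : ℕ
      s = ∑[ u < n ] ∑[ v < n ] up u v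
      size≡s : size G ≡ s
      size≡s = trans (sum-map-tabulate (λ u → count (λ v → (toℕ u <ᵇ toℕ v) ∧ adj G u v)) (λ u → u))
                     (sum-cong-≗ λ u → count≡sum (λ v → (toℕ u <ᵇ toℕ v) ∧ adj G u v))
      split-by-order : ∀ u v → 𝕀 (adj G u v) ≡ up u v + up v u
      split-by-order u v with toℕ u <ᵇ toℕ v | <ᵇ-reflects-< (toℕ u) (toℕ v)
                            | toℕ v <ᵇ toℕ u | <ᵇ-reflects-< (toℕ v) (toℕ u)
      ... | true  | ofʸ u<v | true  | ofʸ v<u = ⊥-elim (<-asym u<v v<u)
      ... | true  | _       | false | _       = ≡.sym (+-identityʳ _)
      ... | false | _       | true  | _       = cong 𝕀 (Graph.sym G u v)
      ... | false | ofⁿ u≮v | false | ofⁿ v≮u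
        rewrite toℕ-injective (≤-antisym (≮⇒≥ v≮u) (≮⇒≥ u≮v)) = cong 𝕀 (irrefl G v)

  deg≤degIn⇒nbrs∈ : ∀ {W : Fin n → Bool} {v u} → deg G v ≤ degIn W v → Adj G v u → W u ≡ true
  deg≤degIn⇒nbrs∈ {v = v} {u} deg≤d vu =
    degIn-mono-equality (λ _ _ _ → refl) (≤-trans (≤-reflexive (≡.sym (deg≡degIn-all v))) deg≤d) u vu refl

  deg-split : ∀ W v → deg G v ≡ degIn W v + degIn (not ∘ W) v
  deg-split W v = trans (deg≡sum v)
    (trans (sum-cong-≗ split) (∑-distrib-+ (λ u → 𝕀 (adj G v u ∧ W u)) (λ u → 𝕀 (adj G v u ∧ not (W u)))))
    where
      split : ∀ u → 𝕀 (adj G v u) ≡ 𝕀 (adj G v u ∧ W u) + 𝕀 (adj G v u ∧ not (W u))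
      split u with adj G v u | W u
      ... | true  | true  = refl
      ... | true  | false = refl
      ... | false | _     = refl

  degIn<deg⇒outside-nbr : ∀ {W : Fin n → Bool} {v} → degIn W v < deg G v → ∃ λ u → Adj G v u × W u ≡ false
  degIn<deg⇒outside-nbr {W} {v} d<deg
    with u , vu , ¬Wu ← degIn-witness (+-cancelˡ-≤ (degIn W v) 1 _
                       (subst₂ _≤_ (+-comm 1 (degIn W v)) (deg-split W v) d<deg))
    = u , vu , not≡true⇒ ¬Wu

  demand : Fin n → ℕ
  demand v = 4 + endDeg v

  charge : (Fin n → Bool) → Fin n → ℕ
  charge W v = (if W v then 3 else deg G v) + degIn W v + 𝕀 (isPenult G v)

  charge-∈ : ∀ {W : Fin n → Bool} {v} → W v ≡ true →
    charge W v ≡ 3 + (degIn W v + 𝕀 (isPenult G v))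
  charge-∈ {W} {v} Wv = cong (λ b → (if b then 3 else deg G v) + degIn W v + 𝕀 (isPenult G v)) Wv

  charge-∉ : ∀ {W : Fin n → Bool} {v} → W v ≡ false →
    charge W v ≡ deg G v + degIn W v + 𝕀 (isPenult G v)
  charge-∉ {W} {v} Wv = cong (λ b → (if b then 3 else deg G v) + degIn W v + 𝕀 (isPenult G v)) Wv

  ∑-demand : ∑[ v < n ] demand v ≡ 4 * n + numEnd G
  ∑-demand = begin
    ∑[ v < n ] (4 + endDeg v)
      ≡⟨ ∑-distrib-+ (λ _ → 4) endDeg ⟩
    ∑[ v < n ] 4 + ∑[ v < n ] endDeg v
      ≡⟨ cong₂ _+_ (trans (sum-const n 4) (*-comm n 4)) (∑-degIn (isEnd G)) ⟩
    4 * n + ∑[ u < n ] (𝕀 (isEnd G u) * deg G u)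
      ≡⟨ cong (4 * n +_) (sum-cong-≗ end-weight) ⟩
    4 * n + ∑[ u < n ] 𝕀 (isEnd G u)
      ≡⟨ cong (4 * n +_) (count≡sum (isEnd G)) ⟨
    4 * n + numEnd G
      ∎
    where
      open ≡-Reasoning
      end-weight : ∀ u → 𝕀 (isEnd G u) * deg G u ≡ 𝕀 (isEnd G u)
      end-weight u with isEnd G u in e
      ... | true  = trans (+-identityʳ (deg G u)) (isEnd⇒deg≡1 e)
      ... | false = refl

  ∑-charge : ∀ W → ∑[ v < n ] charge W v ≡ 3 * count W + 2 * size G + numPenult G
  ∑-charge W = begin
    ∑[ v < n ] (base v + degIn W v + 𝕀 (isPenult G v))
      ≡⟨ ∑-distrib-+ (λ v → base v + degIn W v) (λ v → 𝕀 (isPenult G v)) ⟩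
    ∑[ v < n ] (base v + degIn W v) + ∑[ v < n ] 𝕀 (isPenult G v)
      ≡⟨ cong₂ _+_ (∑-distrib-+ base (degIn W)) (≡.sym (count≡sum (isPenult G))) ⟩
    ∑[ v < n ] base v + ∑[ v < n ] degIn W v + numPenult G
      ≡⟨ cong (λ x → ∑[ v < n ] base v + x + numPenult G) (∑-degIn W) ⟩
    ∑[ v < n ] base v + ∑[ v < n ] (𝕀 (W v) * deg G v) + numPenult G
      ≡⟨ cong (_+ numPenult G) (∑-distrib-+ base (λ v → 𝕀 (W v) * deg G v)) ⟨
    ∑[ v < n ] (base v + 𝕀 (W v) * deg G v) + numPenult G
      ≡⟨ cong (_+ numPenult G) (sum-cong-≗ recombine) ⟩
    ∑[ v < n ] (3 * 𝕀 (W v) + deg G v) + numPenult G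
      ≡⟨ cong (_+ numPenult G) (∑-distrib-+ (λ v → 3 * 𝕀 (W v)) (deg G)) ⟩
    ∑[ v < n ] (3 * 𝕀 (W v)) + ∑[ v < n ] deg G v + numPenult G
      ≡⟨ cong₂ (λ x y → x + y + numPenult G) ∑3𝕀 handshake ⟩
    3 * count W + 2 * size G + numPenult G
      ∎
    where
      open ≡-Reasoning
      base : Fin n → ℕ
      base v = if W v then 3 else deg G v
      recombine : ∀ v → base v + 𝕀 (W v) * deg G v ≡ 3 * 𝕀 (W v) + deg G v
      recombine v with W v
      ... | true  = cong (3 +_) (+-identityʳ (deg G v))
      ... | false = +-identityʳ (deg G v)
      ∑3𝕀 : ∑[ v < n ] (3 * 𝕀 (W v)) ≡ 3 * count W
      ∑3𝕀 = trans (≡.sym (*-distribˡ-sum 3 (λ v → 𝕀 (W v)))) (cong (3 *_) (≡.sym (count≡sum W)))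

  hasLargerEndNbr : Fin n → Bool
  hasLargerEndNbr v = any (λ u → adj G v u ∧ isEnd G u ∧ (toℕ v <ᵇ toℕ u)) (allFin n)

  -- In a K₂ component both vertices are end-vertices; only the one with the larger index is pendant.
  pendant : Fin n → Bool
  pendant v = isEnd G v ∧ not (hasLargerEndNbr v)

  ⇒hasLargerEndNbr : ∀ {v u} → Adj G v u → isEnd G u ≡ true → toℕ v < toℕ u → hasLargerEndNbr v ≡ true
  ⇒hasLargerEndNbr {v} {u} vu eu v<u =
    any-allFin⁺ (λ u → adj G v u ∧ isEnd G u ∧ (toℕ v <ᵇ toℕ u)) u
      (cong₂ _∧_ vu (cong₂ _∧_ eu (Equivalence.to T-≡ (<⇒<ᵇ v<u))))

  pendant⇒ : ∀ {v} → pendant v ≡ true → isEnd G v ≡ true × hasLargerEndNbr v ≡ false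
  pendant⇒ pv with ev , ¬hv ← ∧-≡true⁻ pv = ev , not≡true⇒ ¬hv

  end∧¬pendant⇒larger-end-nbr : ∀ {v u} → isEnd G v ≡ true → pendant v ≡ false → Adj G v u →
    isEnd G u ≡ true × toℕ v < toℕ u
  end∧¬pendant⇒larger-end-nbr {v} {u} ev ¬pv vu
    with w , vw∧ew∧v<w ← any-allFin⁻ (λ w → adj G v w ∧ isEnd G w ∧ (toℕ v <ᵇ toℕ w)) (∧-not≡false⇒ ev ¬pv)
    with vw , ew∧v<w ← ∧-≡true⁻ vw∧ew∧v<w
    with ew , v<w ← ∧-≡true⁻ {isEnd G w} ew∧v<w
    with refl ← end-nbr-unique ev vw vu = ew , <ᵇ⇒< (toℕ v) (toℕ w) (Equivalence.from T-≡ v<w)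

  pendant-nonadjacent : ∀ {u v} → pendant u ≡ true → pendant v ≡ true → ¬ Adj G u v
  pendant-nonadjacent {u} {v} pu pv uv with pendant⇒ pu | pendant⇒ pv | <-cmp (toℕ u) (toℕ v)
  ... | _  , ¬hu | ev , _   | tri< u<v _ _ = false≢true (trans (≡.sym ¬hu) (⇒hasLargerEndNbr uv ev u<v))
  ... | _        | _        | tri≈ _ u≡v _ = Adj-irrefl (subst (λ x → Adj G x v) (toℕ-injective u≡v) uv)
  ... | eu , _   | _  , ¬hv | tri> _ _ v<u =
    false≢true (trans (≡.sym ¬hv) (⇒hasLargerEndNbr (Adj-sym uv) eu v<u))

roleOf : (inS pendant : Bool) → Role
roleOf false _     = rX
roleOf true  true  = rL
roleOf true  false = rY

roleOf≡rX⇒ : ∀ {a b} → roleOf a b ≡ rX → a ≡ false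
roleOf≡rX⇒ {false} _ = refl
roleOf≡rX⇒ {true} {true} ()
roleOf≡rX⇒ {true} {false} ()

roleOf≡rY⇒ : ∀ {a b} → roleOf a b ≡ rY → a ≡ true × b ≡ false
roleOf≡rY⇒ {true} {false} _ = refl , refl
roleOf≡rY⇒ {false} ()
roleOf≡rY⇒ {true} {true} ()

roleOf≡rL⇒ : ∀ {a b} → roleOf a b ≡ rL → a ≡ true × b ≡ true
roleOf≡rL⇒ {true} {true} _ = refl , refl
roleOf≡rL⇒ {false} ()
roleOf≡rL⇒ {true} {false} ()

rL≢rY : rL ≢ rY
rL≢rY ()

module DoubleDominating {n : ℕ} (G : Graph n) (S : Fin n → Bool) (dd : IsDoubleDominating G S) where

  2≤𝕀+degIn : ∀ v → 2 ≤ 𝕀 (S v) + degIn G S v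
  2≤𝕀+degIn v = subst (2 ≤_) (closedNbhdMeet≡ G S v) (dd v)

  ∉S⇒2≤degIn : ∀ {v} → S v ≡ false → 2 ≤ degIn G S v
  ∉S⇒2≤degIn {v} Sv = subst (λ b → 2 ≤ 𝕀 b + degIn G S v) Sv (2≤𝕀+degIn v)

  1≤degIn-S : ∀ v → 1 ≤ degIn G S v
  1≤degIn-S v = s≤s⁻¹ (≤-trans (2≤𝕀+degIn v) (+-monoˡ-≤ (degIn G S v) (𝕀≤1 (S v))))

  end∈S : ∀ {u} → isEnd G u ≡ true → S u ≡ true
  end∈S {u} eu with S u in Su
  ... | true  = refl
  ... | false
    with s≤s () ← ≤-trans (∉S⇒2≤degIn Su) (≤-trans (degIn≤deg G S u) (≤-reflexive (isEnd⇒deg≡1 G eu)))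

  end-nbr∈S : ∀ {u w} → isEnd G u ≡ true → Adj G u w → S w ≡ true
  end-nbr∈S {u} eu = deg≤degIn⇒nbrs∈ G (subst (_≤ degIn G S u) (≡.sym (isEnd⇒deg≡1 G eu)) (1≤degIn-S u))

  ∉S⇒endDeg≡0 : ∀ {v} → S v ≡ false → endDeg G v ≡ 0
  ∉S⇒endDeg≡0 Sv = degIn≡0 G λ u vu eu → false≢true (trans (≡.sym Sv) (end-nbr∈S eu (Adj-sym G vu)))

  suc-endDeg≤degIn+penult : ∀ v → 1 + endDeg G v ≤ degIn G S v + 𝕀 (isPenult G v)
  suc-endDeg≤degIn+penult v with isPenult G v in pv
  ... | true  = subst (1 + endDeg G v ≤_) (+-comm 1 (degIn G S v)) (s≤s (degIn-mono G (λ _ _ eu → end∈S eu)))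
  ... | false = subst₂ _≤_ (cong suc (≡.sym (¬isPenult⇒endDeg≡0 G pv))) (≡.sym (+-identityʳ _)) (1≤degIn-S v)

  demand≤charge : ∀ v → demand G v ≤ charge G S v
  demand≤charge v with S v in Sv
  ... | true  = +-monoʳ-≤ 3 (suc-endDeg≤degIn+penult v)
  ... | false = begin
    demand G v                                 ≡⟨ cong (4 +_) (∉S⇒endDeg≡0 Sv) ⟩
    4                                          ≤⟨ +-mono-≤ (≤-trans 2≤d (degIn≤deg G S v)) 2≤d ⟩
    deg G v + degIn G S v                      ≤⟨ m≤m+n _ _ ⟩
    deg G v + degIn G S v + 𝕀 (isPenult G v)   ∎
    where
      open ≤-Reasoning
      2≤d = ∉S⇒2≤degIn Sv

  lower-bound : 4 * n + numEnd G ≤ 3 * count S + 2 * size G + numPenult G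
  lower-bound = begin
    4 * n + numEnd G                         ≡⟨ ∑-demand G ⟨
    ∑[ v < n ] demand G v                    ≤⟨ sum-mono-≤ demand≤charge ⟩
    ∑[ v < n ] charge G S v                  ≡⟨ ∑-charge G S ⟩
    3 * count S + 2 * size G + numPenult G   ∎
    where open ≤-Reasoning

  module Tight (tight : ∀ v → demand G v ≡ charge G S v) where

    ∉S⇒deg≤2 : ∀ {v} → S v ≡ false → deg G v ≤ 2
    ∉S⇒deg≤2 {v} Sv = +-cancelˡ-≤ 2 (deg G v) 2 (begin
      2 + deg G v                                ≤⟨ +-monoˡ-≤ (deg G v) (∉S⇒2≤degIn Sv) ⟩
      degIn G S v + deg G v                      ≡⟨ +-comm (degIn G S v) (deg G v) ⟩
      deg G v + degIn G S v                      ≤⟨ m≤m+n _ _ ⟩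
      deg G v + degIn G S v + 𝕀 (isPenult G v)   ≡⟨ charge-∉ G Sv ⟨
      charge G S v                               ≡⟨ tight v ⟨
      demand G v                                 ≡⟨ cong (4 +_) (∉S⇒endDeg≡0 Sv) ⟩
      4                                          ∎)
      where open ≤-Reasoning

    ∉S⇒deg≡2 : ∀ {v} → S v ≡ false → deg G v ≡ 2
    ∉S⇒deg≡2 {v} Sv = ≤-antisym (∉S⇒deg≤2 Sv) (≤-trans (∉S⇒2≤degIn Sv) (degIn≤deg G S v))

    ∉S⇒nbrs∈S : ∀ {v u} → S v ≡ false → Adj G v u → S u ≡ true
    ∉S⇒nbrs∈S Sv = deg≤degIn⇒nbrs∈ G (≤-trans (∉S⇒deg≤2 Sv) (∉S⇒2≤degIn Sv))

    ∈S-tight : ∀ {v} → S v ≡ true → 1 + endDeg G v ≡ degIn G S v + 𝕀 (isPenult G v)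
    ∈S-tight {v} Sv = +-cancelˡ-≡ 3 _ _ (trans (tight v) (charge-∈ G Sv))

    ∈S∧¬penult⇒degIn≡1 : ∀ {v} → S v ≡ true → isPenult G v ≡ false → degIn G S v ≡ 1
    ∈S∧¬penult⇒degIn≡1 {v} Sv pv = begin
      degIn G S v                      ≡⟨ +-identityʳ _ ⟨
      degIn G S v + 𝕀 false            ≡⟨ cong (λ b → degIn G S v + 𝕀 b) pv ⟨
      degIn G S v + 𝕀 (isPenult G v)   ≡⟨ ∈S-tight Sv ⟨
      1 + endDeg G v                   ≡⟨ cong suc (¬isPenult⇒endDeg≡0 G pv) ⟩
      1                                ∎
      where open ≡-Reasoning

    ∈S∧penult⇒S-nbrs-end : ∀ {v u} → S v ≡ true → isPenult G v ≡ true →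
      Adj G v u → S u ≡ true → isEnd G u ≡ true
    ∈S∧penult⇒S-nbrs-end {v} {u} Sv pv =
      degIn-mono-equality G (λ _ _ eu → end∈S eu) (≤-reflexive degIn≡endDeg) u
      where
        degIn≡endDeg : degIn G S v ≡ endDeg G v
        degIn≡endDeg = suc-injective (trans (+-comm 1 (degIn G S v))
          (≡.sym (trans (∈S-tight Sv) (cong (λ b → degIn G S v + 𝕀 b) pv))))

    role : Fin n → Role
    role v = roleOf (S v) (pendant G v)

    Y⇒∈S : ∀ {v} → role v ≡ rY → S v ≡ true
    Y⇒∈S rv = proj₁ (roleOf≡rY⇒ rv)

    Y-end⇒larger-end-nbr : ∀ {v u} → role v ≡ rY → isEnd G v ≡ true → Adj G v u →
      isEnd G u ≡ true × toℕ v < toℕ u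
    Y-end⇒larger-end-nbr rv ev = end∧¬pendant⇒larger-end-nbr G ev (proj₂ (roleOf≡rY⇒ rv))

    ∈S∧¬pendant⇒Y : ∀ {v} → S v ≡ true → pendant G v ≡ false → role v ≡ rY
    ∈S∧¬pendant⇒Y Sv pv = cong₂ roleOf Sv pv

    X-nbrs-Y : ∀ u v → role u ≡ rX → Adj G u v → role v ≡ rY
    X-nbrs-Y u v ru uv = ∈S∧¬pendant⇒Y (∉S⇒nbrs∈S Su uv) (¬-not ¬pendant)
      where
        Su = roleOf≡rX⇒ ru
        ¬pendant : pendant G v ≢ true
        ¬pendant pv = false≢true (trans (≡.sym Su) (end-nbr∈S (proj₁ (pendant⇒ G pv)) (Adj-sym G uv)))

    M-matching : ∀ u v w → role u ≡ rY → role v ≡ rY → role w ≡ rY → Adj G u v → Adj G u w → v ≡ w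
    M-matching u v w ru rv rw uv uw with isPenult G u in pu
    ... | false = degIn≤1-unique G (≤-reflexive (∈S∧¬penult⇒degIn≡1 (Y⇒∈S ru) pu)) uv (Y⇒∈S rv) uw (Y⇒∈S rw)
    ... | true  = end-nbr-unique G eu uv uw
      where
        ev = ∈S∧penult⇒S-nbrs-end (Y⇒∈S ru) pu uv (Y⇒∈S rv)
        eu = proj₁ (Y-end⇒larger-end-nbr rv ev (Adj-sym G uv))

    M-ends-X : ∀ u v → role u ≡ rY → role v ≡ rY → Adj G u v → ∃ λ x → role x ≡ rX × Adj G u x
    M-ends-X u v ru rv uv with isPenult G u in pu
    ... | true  = ⊥-elim (<-asym u<v v<u)
      where
        ev = ∈S∧penult⇒S-nbrs-end (Y⇒∈S ru) pu uv (Y⇒∈S rv)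
        eu,v<u = Y-end⇒larger-end-nbr rv ev (Adj-sym G uv)
        v<u = proj₂ eu,v<u
        u<v = proj₂ (Y-end⇒larger-end-nbr ru (proj₁ eu,v<u) uv)
    ... | false =
      let x , ux , Sx = degIn<deg⇒outside-nbr G degIn<deg in x , cong (λ b → roleOf b (pendant G x)) Sx , ux
      where
        degIn≡1 = ∈S∧¬penult⇒degIn≡1 (Y⇒∈S ru) pu
        ¬end : deg G u ≢ 1
        ¬end deg≡1 = false≢true (trans (≡.sym pu)
          (⇒isPenult G uv (proj₁ (Y-end⇒larger-end-nbr ru (deg≡1⇒isEnd G deg≡1) uv))))
        degIn<deg : degIn G S u < deg G u
        degIn<deg = subst (_< deg G u) (≡.sym degIn≡1)
          (≤∧≢⇒< (subst (_≤ deg G u) degIn≡1 (degIn≤deg G S u)) (¬end ∘ ≡.sym))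

    L-deg1 : ∀ u → role u ≡ rL → deg G u ≡ 1
    L-deg1 u ru = isEnd⇒deg≡1 G (proj₁ (pendant⇒ G (proj₂ (roleOf≡rL⇒ ru))))

    L-attach : ∀ u v → role u ≡ rL → Adj G u v → role v ≡ rY × (∀ w → role w ≡ rY → ¬ Adj G v w)
    L-attach u v ru uv = rv , no-Y-nbr
      where
        pu = proj₂ (roleOf≡rL⇒ ru)
        eu = proj₁ (pendant⇒ G pu)
        Sv = end-nbr∈S eu uv
        rv : role v ≡ rY
        rv = ∈S∧¬pendant⇒Y Sv (¬-not λ pv → pendant-nonadjacent G pu pv uv)
        no-Y-nbr : ∀ w → role w ≡ rY → ¬ Adj G v w
        no-Y-nbr w rw vw = rL≢rY (trans (≡.sym ru) (trans (cong role u≡w) rw))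
          where
            ew = ∈S∧penult⇒S-nbrs-end Sv (⇒isPenult G (Adj-sym G uv) eu) vw (Y⇒∈S rw)
            ev = proj₁ (Y-end⇒larger-end-nbr rw ew (Adj-sym G vw))
            u≡w = end-nbr-unique G ev (Adj-sym G uv) vw

    Y-unsat-L : ∀ u → role u ≡ rY → (∃ λ w → role w ≡ rY × Adj G u w) ⊎ (∃ λ l → role l ≡ rL × Adj G u l)
    Y-unsat-L u ru with isPenult G u in pu
    ... | true with l , ul , el ← isPenult⇒ G pu with pendant G l in pl
    ...   | true  = inj₂ (l , cong₂ roleOf (end∈S el) pl , ul)
    ...   | false = inj₁ (l , ∈S∧¬pendant⇒Y (end∈S el) pl , ul)
    Y-unsat-L u ru | false
      with w , uw , Sw ← degIn-witness G (≤-reflexive (≡.sym (∈S∧¬penult⇒degIn≡1 (Y⇒∈S ru) pu)))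
      with pendant G w in pw
    ...   | true  = ⊥-elim (false≢true (trans (≡.sym pu) (⇒isPenult G uw (proj₁ (pendant⇒ G pw)))))
    ...   | false = inj₁ (w , ∈S∧¬pendant⇒Y Sw pw , uw)

    inOmega : InOmega G
    inOmega = role , record
      { X-nbrs-Y   = X-nbrs-Y
      ; X-deg2     = λ u ru → ∉S⇒deg≡2 (roleOf≡rX⇒ ru)
      ; M-matching = M-matching
      ; M-ends-X   = M-ends-X
      ; L-deg1     = L-deg1
      ; L-attach   = L-attach
      ; Y-unsat-L  = Y-unsat-L
      }

notX : Role → Bool
notX rX = false
notX rY = true
notX rL = true

notX≡true⇒ : ∀ {ρ} → notX ρ ≡ true → ρ ≡ rY ⊎ ρ ≡ rL
notX≡true⇒ {rY} _ = inj₁ refl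
notX≡true⇒ {rL} _ = inj₂ refl

module OmegaLabelling {n : ℕ} (G : Graph n) (noIsolated : NoIsolated G) {r : Fin n → Role}
                      (L : IsOmegaLabelling G r) where
  open IsOmegaLabelling L

  Y∪L : Fin n → Bool
  Y∪L v = notX (r v)

  X⇒degIn-Y∪L≡2 : ∀ {v} → r v ≡ rX → degIn G Y∪L v ≡ 2
  X⇒degIn-Y∪L≡2 {v} rv = ≤-antisym (≤-trans (degIn≤deg G Y∪L v) (≤-reflexive (X-deg2 v rv))) (begin
    2                        ≡⟨ X-deg2 v rv ⟨
    deg G v                  ≡⟨ deg≡degIn-all G v ⟩
    degIn G (λ _ → true) v   ≤⟨ degIn-mono G (λ u vu _ → cong notX (X-nbrs-Y v u rv vu)) ⟩
    degIn G Y∪L v            ∎)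
    where open ≤-Reasoning

  2≤𝕀+degIn : ∀ v → 2 ≤ 𝕀 (Y∪L v) + degIn G Y∪L v
  2≤𝕀+degIn v with r v in rv
  ... | rX = ≤-reflexive (≡.sym (X⇒degIn-Y∪L≡2 rv))
  ... | rL = let u , vu = noIsolated v in s≤s (1≤degIn G vu (cong notX (proj₁ (L-attach v u rv vu))))
  ... | rY with Y-unsat-L v rv
  ...   | inj₁ (w , rw , vw) = s≤s (1≤degIn G vw (cong notX rw))
  ...   | inj₂ (l , rl , vl) = s≤s (1≤degIn G vl (cong notX rl))

  Y∪L-isDoubleDominating : IsDoubleDominating G Y∪L
  Y∪L-isDoubleDominating v = subst (2 ≤_) (≡.sym (closedNbhdMeet≡ G Y∪L v)) (2≤𝕀+degIn v)

  charge-Y∪L≤demand : ∀ v → charge G Y∪L v ≤ demand G v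
  charge-Y∪L≤demand v with r v in rv
  ... | rX = begin
    deg G v + degIn G Y∪L v + 𝕀 (isPenult G v)
      ≡⟨ cong₂ (λ a b → a + b + 𝕀 (isPenult G v)) (X-deg2 v rv) (X⇒degIn-Y∪L≡2 rv) ⟩
    4 + 𝕀 (isPenult G v)
      ≤⟨ +-monoʳ-≤ 4 (𝕀-isPenult≤endDeg G v) ⟩
    demand G v
      ∎
    where open ≤-Reasoning
  ... | rL =
    +-monoʳ-≤ 3 (+-mono-≤ (≤-trans (degIn≤deg G Y∪L v) (≤-reflexive (L-deg1 v rv))) (𝕀-isPenult≤endDeg G v))
  ... | rY with Y-unsat-L v rv
  ...   | inj₁ (w , rw , vw) = +-monoʳ-≤ 3 (+-mono-≤ (degIn≤1 G w Y∪L-nbr≡w) (𝕀-isPenult≤endDeg G v))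
    where
      Y∪L-nbr≡w : ∀ u → Adj G v u → Y∪L u ≡ true → u ≡ w
      Y∪L-nbr≡w u vu Y∪Lu = [ (λ ru → M-matching v u w rv ru rw vu vw)
                            , (λ ru → ⊥-elim (proj₂ (L-attach u v ru (Adj-sym G vu)) w rw vw)) ]′ (notX≡true⇒ Y∪Lu)
  ...   | inj₂ (l , rl , vl) =
    +-monoʳ-≤ 3 (subst (degIn G Y∪L v + 𝕀 (isPenult G v) ≤_) (+-comm (endDeg G v) 1)
      (+-mono-≤ (degIn-mono G Y∪L-nbr-end) (𝕀≤1 (isPenult G v))))
    where
      Y∪L-nbr-end : ∀ u → Adj G v u → Y∪L u ≡ true → isEnd G u ≡ true
      Y∪L-nbr-end u vu Y∪Lu = [ (λ ru → ⊥-elim (proj₂ (L-attach l v rl (Adj-sym G vl)) u ru vu))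
                              , (λ ru → deg≡1⇒isEnd G (L-deg1 u ru)) ]′ (notX≡true⇒ Y∪Lu)

  upper-bound : 3 * count Y∪L + 2 * size G + numPenult G ≤ 4 * n + numEnd G
  upper-bound = begin
    3 * count Y∪L + 2 * size G + numPenult G   ≡⟨ ∑-charge G Y∪L ⟨
    ∑[ v < n ] charge G Y∪L v                  ≤⟨ sum-mono-≤ charge-Y∪L≤demand ⟩
    ∑[ v < n ] demand G v                      ≡⟨ ∑-demand G ⟩
    4 * n + numEnd G                           ∎
    where open ≤-Reasoning

theorem3 : ∀ {n : ℕ} (G : Graph n) → NoIsolated G →
    ∀ (S : Fin n → Bool) → IsMinDoubleDominating G S →
      (4 * n + numEnd G ≤ 3 * count S + 2 * size G + numPenult G)
      × ((3 * count S + 2 * size G + numPenult G ≡ 4 * n + numEnd G) ⇔ InOmega G)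
theorem3 {n} G noIsolated S (S-dd , S-min) = lower-bound , mk⇔ equality⇒Ω Ω⇒equality
  where
    open DoubleDominating G S S-dd

    equality⇒Ω : 3 * count S + 2 * size G + numPenult G ≡ 4 * n + numEnd G → InOmega G
    equality⇒Ω eq = Tight.inOmega (sum-mono-≤-equality demand≤charge
      (≤-reflexive (trans (∑-charge G S) (trans eq (≡.sym (∑-demand G))))))

    Ω⇒equality : InOmega G → 3 * count S + 2 * size G + numPenult G ≡ 4 * n + numEnd G
    Ω⇒equality (_ , L) = ≤-antisym (≤-trans S≤Y∪L upper-bound) lower-bound
      where
        open OmegaLabelling G noIsolated L
        S≤Y∪L : 3 * count S + 2 * size G + numPenult G ≤ 3 * count Y∪L + 2 * size G + numPenult G
        S≤Y∪L = +-monoˡ-≤ (numPenult G)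
          (+-monoˡ-≤ (2 * size G) (*-monoʳ-≤ 3 (S-min Y∪L Y∪L-isDoubleDominating)))
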